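{- Let $G=(V,E)$ be a nonempty finite graph in which every vertex carries a loop, let $uv$ be an arbitrary edge of $G$ with $u\neq v$, and let $H$ be the graph obtained from $G$ by deleting the edge $uv$ (all loops kept). Let $f$ be an optimal opinion function of $H$. Then: (i) if $f(u)=f(v)=1$, then $-4\le \gamma(G)-\gamma(H)\le 0$; (ii) if $f(u)=f(v)=-1$, then $-4\le \gamma(G)-\gamma(H)\le 2$; (iii) otherwise (i.e. $f(u)\neq f(v)$), $-4\le \gamma(G)-\gamma(H)\le 2$.
   Context: All graphs are finite with vertex set $V$, $|V|=n$, and every vertex has a loop. For $v\in V$, the neighborhood $N_v=\{w\in V:(v,w)\in E\}$ contains $v$ itself. An opinion function is a map $f:V\to\{ -1,1\}$, extended to subsets by $f(W)=\sum_{w\in W}f(w)$. A vertex $v$ votes "for" if $f(N_v)>0$ and "against" otherwise; $V^+=\{v\in V: f(N_v)>0\}$. The opinion function $f$ is strictly majoritarian on the graph if $|V^+|>|V|/2$. The strict domination number is $\gamma(G)=\min\{f(V): f \text{ strictly majoritarian on } G\}$, and an opinion function of a graph is optimal if it is strictly majoritarian on that graph and $f(V)$ equals its strict domination number. -}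

module Defs where

open import Data.Nat using (ℕ; zero; suc; _<_; _*_)
open import Data.Integer using (ℤ; +_; -_; _+_; _≤_; _>_; 0ℤ; 1ℤ)
open import Data.Integer.Properties using (_<?_)
open import Data.Fin using (Fin; zero; suc; _≟_)
open import Data.Bool using (Bool; true; false; if_then_else_; _∧_; _∨_; not)
open import Data.Bool.Properties using (∨-comm; ∧-comm)
open import Data.Empty using (⊥-elim)
open import Data.Product using (Σ; _×_; _,_)
open import Relation.Nullary using (¬_; does; yes; no)
open import Relation.Binary.PropositionalEquality using (_≡_; refl; trans; cong₂)

record Graph (n : ℕ) : Set where
  field
    adj   : Fin n → Fin n → Bool
    sym   : ∀ x y → adj x y ≡ adj y x
    loops : ∀ x → adj x x ≡ true
open Graph public

∑ : (n : ℕ) → (Fin n → ℤ) → ℤ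
∑ zero    g = 0ℤ
∑ (suc n) g = g zero + ∑ n (λ i → g (suc i))

count : (n : ℕ) → (Fin n → Bool) → ℕ
count zero    p = zero
count (suc n) p = (if p zero then 1 else 0) Data.Nat.+ count n (λ i → p (suc i))

Opinion : ℕ → Set
Opinion n = Fin n → Bool

val : Bool → ℤ
val true  = 1ℤ
val false = - 1ℤ

total : ∀ {n} → Opinion n → ℤ
total {n} f = ∑ n (λ w → val (f w))

nbhdSum : ∀ {n} → Graph n → Opinion n → Fin n → ℤ
nbhdSum {n} G f v = ∑ n (λ w → if adj G v w then val (f w) else 0ℤ)

votesFor : ∀ {n} → Graph n → Opinion n → Fin n → Bool
votesFor G f v = does (0ℤ <? nbhdSum G f v)

numFor : ∀ {n} → Graph n → Opinion n → ℕ
numFor {n} G f = count n (votesFor G f)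

StrictlyMajoritarian : ∀ {n} → Graph n → Opinion n → Set
StrictlyMajoritarian {n} G f = n < 2 * numFor G f

IsStrictDomNumber : ∀ {n} → Graph n → ℤ → Set
IsStrictDomNumber {n} G k =
  Σ (Opinion n) (λ f → StrictlyMajoritarian G f × total f ≡ k)
  × (∀ g → StrictlyMajoritarian G g → k ≤ total g)

Optimal : ∀ {n} → Graph n → Opinion n → Set
Optimal G f = StrictlyMajoritarian G f × IsStrictDomNumber G (total f)

samePair : ∀ {n} → Fin n → Fin n → Fin n → Fin n → Bool
samePair x y u v =
  (does (x ≟ u) ∧ does (y ≟ v)) Data.Bool.∨ (does (x ≟ v) ∧ does (y ≟ u))

private
  loopLemma : ∀ {n} (G : Graph n) (u v x : Fin n) → ¬ (u ≡ v) →
              (adj G x x ∧ not (samePair x x u v)) ≡ true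
  loopLemma G u v x u≢v with x ≟ u | x ≟ v
  ... | yes refl | yes refl = ⊥-elim (u≢v refl)
  ... | yes refl | no _ rewrite loops G x = refl
  ... | no _ | yes refl rewrite loops G x = refl
  ... | no _ | no _ rewrite loops G x = refl

  swapP : ∀ {n} (u v x y : Fin n) → samePair x y u v ≡ samePair y x u v
  swapP u v x y = trans (∨-comm (does (x ≟ u) ∧ does (y ≟ v)) (does (x ≟ v) ∧ does (y ≟ u)))
    (cong₂ _∨_ (∧-comm (does (x ≟ v)) (does (y ≟ u))) (∧-comm (does (x ≟ u)) (does (y ≟ v))))

deleteEdge : ∀ {n} → (G : Graph n) → (u v : Fin n) → ¬ (u ≡ v) → Graph n
deleteEdge {n} G u v u≢v = record
  { adj   = λ x y → adj G x y ∧ not (samePair x y u v)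
  ; sym   = λ x y → cong₂ (λ a b → a ∧ not b) (Graph.sym G x y) (swapP u v x y)
  ; loops = λ x → loopLemma G u v x u≢v }

-- Deleting or adding the edge uv changes only the neighbourhood sums of u and v, each by
-- the opinion at the other endpoint.  From an optimal opinion of G one obtains a strictly
-- majoritarian opinion of H = G − uv by raising at most one voter near u and one near v:
-- if some neighbour of the endpoint is against, raising it adds 2 to the endpoint's sum,
-- and otherwise the endpoint already votes for; hence γ(H) ≤ γ(G) + 4.  Conversely an
-- optimal opinion f of H stays strictly majoritarian on G when f(u) = f(v) = 1, and after
-- raising an endpoint that is against otherwise; hence γ(G) ≤ γ(H), resp. γ(G) ≤ γ(H) + 2.
module Submission where

open import Defs hiding (sym)
open import Data.Nat as ℕ using (NonZero; zero; suc)
import Data.Nat.Properties as ℕ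
open import Data.Integer using (ℤ; _≤_; _<_; _-_; -_; +_; -[1+_]; 0ℤ; 1ℤ; _+_; +≤+; +<+; -≤+)
open import Data.Integer.Properties as ℤ using (_<?_)
open import Data.Integer.Tactic.RingSolver using (solve-∀)
open import Data.Fin using (Fin; zero; suc; _≟_)
open import Data.Fin.Properties using (any?; suc-injective)
open import Data.Vec.Functional using (updateAt)
open import Data.Vec.Functional.Properties using (updateAt-updates; updateAt-minimal)
open import Data.Bool using (Bool; true; false; if_then_else_)
open import Data.Bool.Properties using (∧-identityʳ; ∧-zeroʳ; ¬-not) renaming (_≟_ to _≟ᵇ_)
open import Data.Product using (Σ; _×_; _,_)
open import Data.Empty using (⊥-elim)
open import Function using (const; _∘_)
open import Relation.Nullary using (¬_; Dec; does; yes; no)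
open import Relation.Nullary.Decidable using (dec-true; dec-false; _×-dec_)
open import Relation.Binary.PropositionalEquality

∑-cong : ∀ n {g h : Fin n → ℤ} → (∀ i → g i ≡ h i) → ∑ n g ≡ ∑ n h
∑-cong zero    e = refl
∑-cong (suc n) e = cong₂ _+_ (e zero) (∑-cong n (λ i → e (suc i)))

∑-mono-≤ : ∀ n {g h : Fin n → ℤ} → (∀ i → g i ≤ h i) → ∑ n g ≤ ∑ n h
∑-mono-≤ zero    le = ℤ.≤-refl
∑-mono-≤ (suc n) le = ℤ.+-mono-≤ (le zero) (∑-mono-≤ n (λ i → le (suc i)))

∑-nonneg : ∀ n {g : Fin n → ℤ} → (∀ i → 0ℤ ≤ g i) → 0ℤ ≤ ∑ n g
∑-nonneg zero    nn = ℤ.≤-refl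
∑-nonneg (suc n) nn = ℤ.+-mono-≤ (nn zero) (∑-nonneg n (λ i → nn (suc i)))

∑-pos : ∀ n {g : Fin n → ℤ} (w : Fin n) → (∀ i → 0ℤ ≤ g i) → 0ℤ < g w → 0ℤ < ∑ n g
∑-pos (suc n) zero    nn pos = ℤ.+-mono-<-≤ pos (∑-nonneg n (λ i → nn (suc i)))
∑-pos (suc n) (suc w) nn pos = ℤ.+-mono-≤-< (nn zero) (∑-pos n w (λ i → nn (suc i)) pos)

∑-update : ∀ n (g h : Fin n → ℤ) (w : Fin n) → (∀ i → ¬ i ≡ w → g i ≡ h i) →
           ∑ n h ≡ ∑ n g + (h w - g w)
∑-update (suc n) g h zero agree =
  trans (cong (λ s → h zero + s) (sym (∑-cong n (λ i → agree (suc i) λ ())))) (shift (h zero) (g zero) _)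
  where
  shift : ∀ (a b s : ℤ) → a + s ≡ b + s + (a - b)
  shift = solve-∀
∑-update (suc n) g h (suc w) agree =
  trans (cong₂ _+_ (sym (agree zero λ ())) (∑-update n _ _ w (λ i i≢w → agree (suc i) (i≢w ∘ suc-injective))))
        (sym (ℤ.+-assoc (g zero) _ _))

val-≤-1 : ∀ b → val b ≤ 1ℤ
val-≤-1 true  = ℤ.≤-refl
val-≤-1 false = -≤+

0≤2+val : ∀ b → 0ℤ ≤ + 2 + val b
0≤2+val true  = +≤+ ℕ.z≤n
0≤2+val false = +≤+ ℕ.z≤n

0<i+1⇒0≤i : ∀ {i} → 0ℤ < i + 1ℤ → 0ℤ ≤ i
0<i+1⇒0≤i {+ _}             _          = +≤+ ℕ.z≤n
0<i+1⇒0≤i { -[1+ zero ]}    (+<+ ())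
0<i+1⇒0≤i { -[1+ suc _ ]}   ()

0<i+val⇒0≤i : ∀ {i} b → 0ℤ < i + val b → 0ℤ ≤ i
0<i+val⇒0≤i {i} b pos = 0<i+1⇒0≤i (ℤ.<-≤-trans pos (ℤ.+-monoʳ-≤ i (val-≤-1 b)))

_⊑_ : ∀ {n} → Opinion n → Opinion n → Set
f ⊑ f′ = ∀ i → f i ≡ true → f′ i ≡ true

⊑-refl : ∀ {n} {f : Opinion n} → f ⊑ f
⊑-refl _ e = e

⊑-trans : ∀ {n} {f g h : Opinion n} → f ⊑ g → g ⊑ h → f ⊑ h
⊑-trans f⊑g g⊑h i e = g⊑h i (f⊑g i e)

val-mono : ∀ {b b′} → (b ≡ true → b′ ≡ true) → val b ≤ val b′
val-mono {true}  imp rewrite imp refl = ℤ.≤-refl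
val-mono {false} {true}  _ = -≤+
val-mono {false} {false} _ = ℤ.≤-refl

nbhdSum-mono : ∀ {n} (K : Graph n) {f f′ : Opinion n} → f ⊑ f′ → ∀ x → nbhdSum K f x ≤ nbhdSum K f′ x
nbhdSum-mono {n} K {f} {f′} f⊑f′ x = ∑-mono-≤ n term-mono
  where
  term-mono : ∀ w → (if adj K x w then val (f w) else 0ℤ) ≤ (if adj K x w then val (f′ w) else 0ℤ)
  term-mono w with adj K x w
  ... | true  = val-mono (f⊑f′ w)
  ... | false = ℤ.≤-refl

nbhdSum-pos : ∀ {n} (K : Graph n) (f : Opinion n) x →
              (∀ w → adj K x w ≡ true → f w ≡ true) → 0ℤ < nbhdSum K f x
nbhdSum-pos {n} K f x allFor = ∑-pos n x term-nonneg term-at-x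
  where
  term-nonneg : ∀ w → 0ℤ ≤ (if adj K x w then val (f w) else 0ℤ)
  term-nonneg w with adj K x w in xw
  ... | true rewrite allFor w xw = +≤+ ℕ.z≤n
  ... | false = ℤ.≤-refl
  term-at-x : 0ℤ < (if adj K x x then val (f x) else 0ℤ)
  term-at-x rewrite loops K x | allFor x (loops K x) = +<+ (ℕ.s≤s ℕ.z≤n)

raise : ∀ {n} → Opinion n → Fin n → Opinion n
raise f w = updateAt f w (const true)

raise-extends : ∀ {n} (f : Opinion n) w → f ⊑ raise f w
raise-extends f w i fi with i ≟ w
... | yes refl = updateAt-updates i f
... | no  i≢w  = trans (updateAt-minimal i w f i≢w) fi

∑-raise : ∀ {n} (f : Opinion n) (w : Fin n) (c : Fin n → Bool → ℤ) →
          ∑ n (λ i → c i (raise f w i)) ≡ ∑ n (λ i → c i (f i)) + (c w true - c w (f w))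
∑-raise {n} f w c =
  trans (∑-update n _ _ w (λ i i≢w → cong (c i) (sym (updateAt-minimal i w f i≢w))))
        (cong (λ b → ∑ n (λ i → c i (f i)) + (c w b - c w (f w))) (updateAt-updates w f))

total-raise : ∀ {n} (f : Opinion n) w → total (raise f w) ≤ total f + + 2
total-raise f w rewrite ∑-raise f w (λ _ → val) with f w
... | true  = ℤ.+-monoʳ-≤ (total f) (+≤+ ℕ.z≤n)
... | false = ℤ.≤-refl

nbhdSum-raise : ∀ {n} (K : Graph n) (f : Opinion n) x w → adj K x w ≡ true → f w ≡ false →
                nbhdSum K (raise f w) x ≡ nbhdSum K f x + + 2
nbhdSum-raise K f x w xw fw
  rewrite ∑-raise f w (λ i b → if adj K x i then val b else 0ℤ) | xw | fw = refl

nbhdSum-cong : ∀ {n} (K K′ : Graph n) (f : Opinion n) x →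
               (∀ i → adj K x i ≡ adj K′ x i) → nbhdSum K f x ≡ nbhdSum K′ f x
nbhdSum-cong {n} K K′ f x same = ∑-cong n (λ i → cong (λ b → if b then val (f i) else 0ℤ) (same i))

nbhdSum-extraNeighbour : ∀ {n} (K K′ : Graph n) (f : Opinion n) x y →
                         adj K x y ≡ true → adj K′ x y ≡ false →
                         (∀ i → ¬ i ≡ y → adj K x i ≡ adj K′ x i) →
                         nbhdSum K f x ≡ nbhdSum K′ f x + val (f y)
nbhdSum-extraNeighbour {n} K K′ f x y xy∈K xy∉K′ same =
  trans (∑-update n _ _ y (λ i i≢y → cong (λ b → if b then val (f i) else 0ℤ) (sym (same i i≢y))))
        (cong (λ s → nbhdSum K′ f x + s) extra)
  where
  extra : (if adj K x y then val (f y) else 0ℤ) - (if adj K′ x y then val (f y) else 0ℤ) ≡ val (f y)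
  extra rewrite xy∈K | xy∉K′ = ℤ.+-identityʳ (val (f y))

count-mono : ∀ n {p q : Fin n → Bool} → (∀ i → p i ≡ true → q i ≡ true) → count n p ℕ.≤ count n q
count-mono zero    _ = ℕ.z≤n
count-mono (suc n) {p} {q} imp with p zero | q zero | imp zero
... | true  | true  | _ = ℕ.s≤s (count-mono n (λ i → imp (suc i)))
... | true  | false | k with () ← k refl
... | false | true  | _ = ℕ.m≤n⇒m≤1+n (count-mono n (λ i → imp (suc i)))
... | false | false | _ = count-mono n (λ i → imp (suc i))

dec-true⁻¹ : ∀ {A : Set} (a? : Dec A) → does a? ≡ true → A
dec-true⁻¹ (yes a) _ = a

-- A record rather than a function type, so that K, f, K′ and f′ are inferable from it.
record VoteKept {n} (K : Graph n) (f : Opinion n) (K′ : Graph n) (f′ : Opinion n) (x : Fin n) : Set where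
  constructor voteKept
  field keeps : 0ℤ < nbhdSum K f x → 0ℤ < nbhdSum K′ f′ x

majoritarian-transfer : ∀ {n} {K K′ : Graph n} {f f′ : Opinion n} →
                        (∀ x → VoteKept K f K′ f′ x) →
                        StrictlyMajoritarian K f → StrictlyMajoritarian K′ f′
majoritarian-transfer {n} {K} {K′} {f} {f′} kept maj =
  ℕ.<-≤-trans maj (ℕ.*-monoʳ-≤ 2 (count-mono n votes))
  where
  votes : ∀ x → votesFor K f x ≡ true → votesFor K′ f′ x ≡ true
  votes x e = dec-true (0ℤ <? _) (VoteKept.keeps (kept x) (dec-true⁻¹ (0ℤ <? nbhdSum K f x) e))

votesKept-by-cases : ∀ {n} {K K′ : Graph n} {f f′ : Opinion n} (a b : Fin n) →
                     VoteKept K f K′ f′ a → VoteKept K f K′ f′ b →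
                     (∀ x → ¬ x ≡ a → ¬ x ≡ b → VoteKept K f K′ f′ x) →
                     ∀ x → VoteKept K f K′ f′ x
votesKept-by-cases a b at-a at-b elsewhere x with x ≟ a | x ≟ b
... | yes refl | _        = at-a
... | no  _    | yes refl = at-b
... | no  x≢a  | no  x≢b  = elsewhere x x≢a x≢b

record Recruitment {n} (K : Graph n) (f : Opinion n) (x : Fin n) : Set where
  field
    opinion : Opinion n
    extends : f ⊑ opinion
    cost    : total opinion ≤ total f + + 2
    votes   : 0ℤ ≤ nbhdSum K f x → 0ℤ < nbhdSum K opinion x

recruit : ∀ {n} (K : Graph n) (f : Opinion n) x → Recruitment K f x
recruit K f x with any? (λ w → (adj K x w ≟ᵇ true) ×-dec (f w ≟ᵇ false))
... | yes (w , xw , fw) = record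
  { opinion = raise f w
  ; extends = raise-extends f w
  ; cost    = total-raise f w
  ; votes   = λ 0≤s → subst (0ℤ <_) (sym (nbhdSum-raise K f x w xw fw))
                                     (ℤ.+-mono-≤-< 0≤s (+<+ (ℕ.s≤s ℕ.z≤n)))
  }
... | no noneAgainst = record
  { opinion = f
  ; extends = ⊑-refl
  ; cost    = ℤ.i≤i+j (total f) (+ 2)
  ; votes   = λ _ → nbhdSum-pos K f x (λ w xw → ¬-not (λ fw → noneAgainst (w , xw , fw)))
  }

-- H is G without the edge ab, as far as neighbourhood sums can tell.
record EdgeDeletion {n} (G H : Graph n) (a b : Fin n) : Set where
  field
    at-left   : ∀ f → nbhdSum G f a ≡ nbhdSum H f a + val (f b)
    at-right  : ∀ f → nbhdSum G f b ≡ nbhdSum H f b + val (f a)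
    elsewhere : ∀ f x → ¬ x ≡ a → ¬ x ≡ b → nbhdSum G f x ≡ nbhdSum H f x

EdgeDeletion-swap : ∀ {n} {G H : Graph n} {a b} → EdgeDeletion G H a b → EdgeDeletion G H b a
EdgeDeletion-swap D = record
  { at-left   = at-right
  ; at-right  = at-left
  ; elsewhere = λ f x x≢b x≢a → elsewhere f x x≢a x≢b
  }
  where open EdgeDeletion D

module _ {n} (G : Graph n) (u v : Fin n) (u≢v : ¬ u ≡ v) where

  private
    H = deleteEdge G u v u≢v

    adj-deleteEdge : ∀ x i → samePair x i u v ≡ false → adj H x i ≡ adj G x i
    adj-deleteEdge x i off rewrite off = ∧-identityʳ (adj G x i)

    adj-deleteEdge-removed : ∀ x i → samePair x i u v ≡ true → adj H x i ≡ false
    adj-deleteEdge-removed x i on rewrite on = ∧-zeroʳ (adj G x i)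

    v≢u : ¬ v ≡ u
    v≢u = u≢v ∘ sym

  deleteEdge-deletion : adj G u v ≡ true → EdgeDeletion G H u v
  deleteEdge-deletion uv = record
    { at-left   = λ f → nbhdSum-extraNeighbour G H f u v uv
                          (adj-deleteEdge-removed u v pair-uv)
                          (λ i i≢v → sym (adj-deleteEdge u i (off-u i i≢v)))
    ; at-right  = λ f → nbhdSum-extraNeighbour G H f v u (trans (Graph.sym G v u) uv)
                          (adj-deleteEdge-removed v u pair-vu)
                          (λ i i≢u → sym (adj-deleteEdge v i (off-v i i≢u)))
    ; elsewhere = λ f x x≢u x≢v → nbhdSum-cong G H f x (λ i → sym (adj-deleteEdge x i (off-x x i x≢u x≢v)))
    }
    where
    pair-uv : samePair u v u v ≡ true
    pair-uv rewrite dec-true (u ≟ u) refl | dec-true (v ≟ v) refl = refl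
    pair-vu : samePair v u u v ≡ true
    pair-vu rewrite dec-false (v ≟ u) v≢u | dec-true (v ≟ v) refl | dec-true (u ≟ u) refl = refl
    off-u : ∀ i → ¬ i ≡ v → samePair u i u v ≡ false
    off-u i i≢v rewrite dec-true (u ≟ u) refl | dec-false (i ≟ v) i≢v | dec-false (u ≟ v) u≢v = refl
    off-v : ∀ i → ¬ i ≡ u → samePair v i u v ≡ false
    off-v i i≢u rewrite dec-true (v ≟ v) refl | dec-false (i ≟ u) i≢u | dec-false (v ≟ u) v≢u = refl
    off-x : ∀ x i → ¬ x ≡ u → ¬ x ≡ v → samePair x i u v ≡ false
    off-x x i x≢u x≢v rewrite dec-false (x ≟ u) x≢u | dec-false (x ≟ v) x≢v = refl

module _ {n} {G H : Graph n} {a b : Fin n} (D : EdgeDeletion G H a b) where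
  open EdgeDeletion D

  private
    voteKept-at-endpoint : ∀ {f f′ : Opinion n} {x y} →
                           (∀ g → nbhdSum G g x ≡ nbhdSum H g x + val (g y)) →
                           f ⊑ f′ → f′ y ≡ true → VoteKept H f G f′ x
    voteKept-at-endpoint {f} {f′} {x} {y} split f⊑f′ f′y = voteKept keeps
      where
      keeps : 0ℤ < nbhdSum H f x → 0ℤ < nbhdSum G f′ x
      keeps pos rewrite split f′ | f′y = ℤ.+-mono-<-≤ (ℤ.<-≤-trans pos (nbhdSum-mono H f⊑f′ x)) (+≤+ ℕ.z≤n)

    voteKept-elsewhere : ∀ {K K′ : Graph n} {f f′ : Opinion n} →
                         (∀ g x → ¬ x ≡ a → ¬ x ≡ b → nbhdSum K g x ≡ nbhdSum K′ g x) →
                         f ⊑ f′ → ∀ x → ¬ x ≡ a → ¬ x ≡ b → VoteKept K f K′ f′ x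
    voteKept-elsewhere {K} {f′ = f′} same f⊑f′ x x≢a x≢b = voteKept λ pos →
      subst (0ℤ <_) (same f′ x x≢a x≢b) (ℤ.<-≤-trans pos (nbhdSum-mono K f⊑f′ x))

  addEdge-majoritarian : ∀ {f} → f a ≡ true → f b ≡ true →
                         StrictlyMajoritarian H f → StrictlyMajoritarian G f
  addEdge-majoritarian fa fb = majoritarian-transfer (votesKept-by-cases a b
    (voteKept-at-endpoint at-left ⊑-refl fb)
    (voteKept-at-endpoint at-right ⊑-refl fa)
    (voteKept-elsewhere (λ g x x≢a x≢b → sym (elsewhere g x x≢a x≢b)) ⊑-refl))

  addEdge-raise-majoritarian : ∀ {f} → f b ≡ false →
                               StrictlyMajoritarian H f → StrictlyMajoritarian G (raise f b)
  addEdge-raise-majoritarian {f} fb = majoritarian-transfer (votesKept-by-cases a b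
    (voteKept-at-endpoint at-left (raise-extends f b) (updateAt-updates b f))
    (voteKept at-raised)
    (voteKept-elsewhere (λ g x x≢a x≢b → sym (elsewhere g x x≢a x≢b)) (raise-extends f b)))
    where
    at-raised : 0ℤ < nbhdSum H f b → 0ℤ < nbhdSum G (raise f b) b
    at-raised pos
      rewrite at-right (raise f b) | nbhdSum-raise H f b b (loops H b) fb
            | ℤ.+-assoc (nbhdSum H f b) (+ 2) (val (raise f b a)) =
      ℤ.+-mono-<-≤ pos (0≤2+val (raise f b a))

  deleteEdge-repair : ∀ g → StrictlyMajoritarian G g →
                      Σ (Opinion n) λ g′ → StrictlyMajoritarian H g′ × total g′ ≤ total g + + 4
  deleteEdge-repair g maj = g₂ , majoritarian-transfer kept maj , total-g₂
    where
    open Recruitment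
    r₁ = recruit H g a
    g₁ = opinion r₁
    r₂ = recruit H g₁ b
    g₂ = opinion r₂

    total-g₂ : total g₂ ≤ total g + + 4
    total-g₂ = begin
      total g₂              ≤⟨ cost r₂ ⟩
      total g₁ + + 2        ≤⟨ ℤ.+-monoˡ-≤ (+ 2) (cost r₁) ⟩
      total g + + 2 + + 2   ≡⟨ ℤ.+-assoc (total g) (+ 2) (+ 2) ⟩
      total g + + 4         ∎
      where open ℤ.≤-Reasoning

    kept : ∀ x → VoteKept G g H g₂ x
    kept = votesKept-by-cases a b
      (voteKept λ pos → ℤ.<-≤-trans (votes r₁ (0<i+val⇒0≤i (g b) (subst (0ℤ <_) (at-left g) pos)))
                                    (nbhdSum-mono H (extends r₂) a))
      (voteKept λ pos → votes r₂ (0<i+val⇒0≤i (g₁ a) (subst (0ℤ <_) (at-right g₁)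
                                    (ℤ.<-≤-trans pos (nbhdSum-mono G (extends r₁) b)))))
      (voteKept-elsewhere elsewhere (⊑-trans (extends r₁) (extends r₂)))

i≤j+k⇒i-j≤k : ∀ {i j : ℤ} k → i ≤ j + k → i - j ≤ k
i≤j+k⇒i-j≤k {i} {j} k le = begin
  i - j              ≤⟨ ℤ.+-monoˡ-≤ (- j) le ⟩
  j + k - j          ≡⟨ cancel j k ⟩
  k                  ∎
  where
  open ℤ.≤-Reasoning
  cancel : ∀ (x y : ℤ) → x + y - x ≡ y
  cancel = solve-∀

j≤i+k⇒-k≤i-j : ∀ {i j : ℤ} k → j ≤ i + k → - k ≤ i - j
j≤i+k⇒-k≤i-j {i} {j} k le = begin
  - k                ≡⟨ cancel i k ⟨
  i - (i + k)        ≤⟨ ℤ.+-monoʳ-≤ i (ℤ.neg-mono-≤ le) ⟩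
  i - j              ∎
  where
  open ℤ.≤-Reasoning
  cancel : ∀ (x y : ℤ) → x - (x + y) ≡ - y
  cancel = solve-∀

lemma3 : ∀ {n} .{{_ : NonZero n}} (G : Graph n) (u v : Fin n) (u≢v : ¬ (u ≡ v)) →
         adj G u v ≡ true →
         (f : Opinion n) → Optimal (deleteEdge G u v u≢v) f →
         (γG γH : ℤ) → IsStrictDomNumber G γG → IsStrictDomNumber (deleteEdge G u v u≢v) γH →
         (f u ≡ true → f v ≡ true → (- (+ 4) ≤ γG - γH) × (γG - γH ≤ + 0))
         × (f u ≡ false → f v ≡ false → (- (+ 4) ≤ γG - γH) × (γG - γH ≤ + 2))
         × (¬ (f u ≡ f v) → (- (+ 4) ≤ γG - γH) × (γG - γH ≤ + 2))
lemma3 G u v u≢v uv f (majf , _ , f-min) γG γH ((g , majg , refl) , γG-min) ((h , majh , refl) , γH-min) =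
  (λ fu fv → lower , ℤ.i≤j⇒i-j≤0 (ℤ.≤-trans (γG-min f (addEdge-majoritarian D fu fv majf)) f≤γH)) ,
  (λ _ fv → lower , raised D fv) ,
  different
  where
  D = deleteEdge-deletion G u v u≢v uv

  f≤γH : total f ≤ total h
  f≤γH = f-min h majh

  lower : - (+ 4) ≤ total g - total h
  lower with deleteEdge-repair D g majg
  ... | g′ , majg′ , cost = j≤i+k⇒-k≤i-j {total g} (+ 4) (ℤ.≤-trans (γH-min g′ majg′) cost)

  raised : ∀ {a b} → EdgeDeletion G (deleteEdge G u v u≢v) a b → f b ≡ false → total g - total h ≤ + 2
  raised {b = b} D′ fb = i≤j+k⇒i-j≤k (+ 2) (begin
    total g               ≤⟨ γG-min (raise f b) (addEdge-raise-majoritarian D′ fb majf) ⟩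
    total (raise f b)     ≤⟨ total-raise f b ⟩
    total f + + 2         ≤⟨ ℤ.+-monoˡ-≤ (+ 2) f≤γH ⟩
    total h + + 2         ∎)
    where open ℤ.≤-Reasoning

  different : ¬ f u ≡ f v → (- (+ 4) ≤ total g - total h) × (total g - total h ≤ + 2)
  different fu≢fv with f u in fu | f v in fv
  ... | true  | true  = ⊥-elim (fu≢fv refl)
  ... | true  | false = lower , raised D fv
  ... | false | _     = lower , raised (EdgeDeletion-swap D) fu
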